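{- Let $G=(V,E)$ be a finite simple undirected graph in which every vertex has degree at most $3$ and in which some vertex of degree $3$ is not a cut vertex. Let $(G,\mathcal{L})$ be a linear reassembling and $(G,\varphi)$ a linear arrangement of $G$ such that $(G,\mathcal{L})$ is induced by $(G,\varphi)$ or $(G,\varphi)$ is induced by $(G,\mathcal{L})$. Then $\alpha(G,\mathcal{L})=\alpha(G,\varphi)$, and $(G,\mathcal{L})$ is $\alpha$-optimal if and only if $(G,\varphi)$ is $\alpha$-optimal.
   Context: Let $n=|V|$. For $X\subseteq V$, $\deg_G(X)$ is the number of edges with exactly one endpoint in $X$ (for a vertex, this is its usual degree). A linear binary tree over $V$ is a collection $\mathcal{L}=\{\{v_j\}\mid 1\le j\le n\}\cup\{\{v_1,\dots,v_k\}\mid 2\le k\le n\}$ for some enumeration $v_1,\dots,v_n$ of $V$ (the enumeration is determined by $\mathcal{L}$ up to swapping $v_1,v_2$); $(G,\mathcal{L})$ is then called a linear reassembling of $G$, with $\alpha(G,\mathcal{L})=\max_{X\in\mathcal{L}}\deg_G(X)$. $(G,\mathcal{L})$ is $\alpha$-optimal if $\alpha(G,\mathcal{L})$ is minimal among all linear reassemblings of $G$. A linear arrangement is a bijection $\varphi:V\to\{1,\dots,n\}$, with $\alpha(G,\varphi)=\max_{1\le i\le n}\deg_G(\{v\mid\varphi(v)\le i\})$; it is $\alpha$-optimal if $\alpha(G,\varphi)$ is minimal among all linear arrangements of $G$. The linear arrangement induced by $(G,\mathcal{L})$ (enumeration $v_1,\dots,v_n$) is $\varphi$ with $\varphi(v_i)=i$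 for $i\ge 3$ and $\{\varphi(v_1),\varphi(v_2)\}=\{1,2\}$, the one of $v_1,v_2$ of smaller (or, in case of a tie, either) degree being placed at position $1$. The linear reassembling induced by $(G,\varphi)$ is the one with enumeration $\varphi^{ -1}(1),\dots,\varphi^{ -1}(n)$. A cut vertex is a vertex whose removal increases the number of connected components. -}

module Defs where

open import Data.Nat using (ℕ; zero; suc; _+_; _⊔_; _≤_; _<_; _<ᵇ_)
open import Data.Bool using (Bool; true; false; _∧_; _∨_; not; if_then_else_)
open import Data.Fin using (Fin; zero; suc; toℕ; _≟_)
open import Data.List using (List; []; _∷_; _++_; map; foldr; allFin; applyUpTo)
open import Data.Nat.ListAction using (sum)
open import Data.Bool.ListAction using (any)
open import Data.Fin.Permutation using (Permutation′; _⟨$⟩ʳ_; _⟨$⟩ˡ_)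
open import Data.Product using (Σ; _×_)
open import Data.Sum using (_⊎_)
open import Data.Unit using (⊤)
open import Relation.Nullary.Decidable using (⌊_⌋)
open import Relation.Binary.PropositionalEquality using (_≡_)

record Graph (n : ℕ) : Set where
  field
    adj    : Fin n → Fin n → Bool
    sym    : ∀ u v → adj u v ≡ adj v u
    irrefl : ∀ v → adj v v ≡ false
open Graph public

VSet : ℕ → Set
VSet n = Fin n → Bool

sumV : ∀ {n} → (Fin n → ℕ) → ℕ
sumV {n} f = sum (map f (allFin n))

-- deg_G(X): number of edges with exactly one endpoint in X.
-- Each such edge {u,v} is counted once, as the ordered pair (u,v) with u ∈ X, v ∉ X.
degSet : ∀ {n} → Graph n → VSet n → ℕ
degSet G X = sumV (λ u → sumV (λ v → if adj G u v ∧ X u ∧ not (X v) then 1 else 0))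

singleton : ∀ {n} → Fin n → VSet n
singleton v u = ⌊ u ≟ v ⌋

deg : ∀ {n} → Graph n → Fin n → ℕ
deg G v = degSet G (singleton v)

maxList : List ℕ → ℕ
maxList = foldr _⊔_ 0

reachIter : ∀ {n} → Graph n → VSet n → ℕ → Fin n → Fin n → Bool
reachIter G S zero    u w = ⌊ u ≟ w ⌋ ∧ S u
reachIter {n} G S (suc k) u w =
  reachIter G S k u w ∨ any (λ x → reachIter G S k u x ∧ adj G x w ∧ S w) (allFin n)

reach : ∀ {n} → Graph n → VSet n → Fin n → Fin n → Bool
reach {n} G S = reachIter G S n

-- Number of connected components of G[S]: count the vertices of S that are
-- the least (by index) vertex of their component.
numComponents : ∀ {n} → Graph n → VSet n → ℕ
numComponents {n} G S =
  sumV (λ v → if S v ∧ not (any (λ u → (toℕ u <ᵇ toℕ v) ∧ reach G S u v) (allFin n))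
              then 1 else 0)

IsCutVertex : ∀ {n} → Graph n → Fin n → Set
IsCutVertex G v = numComponents G (λ _ → true) < numComponents G (λ u → not ⌊ u ≟ v ⌋)

-- An enumeration v₁,…,vₙ of V: e ⟨$⟩ʳ i is the vertex v_{i+1} (positions are 0-based).
-- A linear reassembling (G, L) is given by an enumeration e of L; the linear
-- binary tree L itself is the collection `linearBinaryTree e` below.
Enumeration : ℕ → Set
Enumeration n = Permutation′ n

prefixSet : ∀ {n} → Enumeration n → ℕ → VSet n
prefixSet e k u = toℕ (e ⟨$⟩ˡ u) <ᵇ k

linearBinaryTree : ∀ {n} → Enumeration n → List (VSet n)
linearBinaryTree {n} e =
  map singleton (allFin n) ++ applyUpTo (λ j → prefixSet e (2 + j)) (n Data.Nat.∸ 1)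

αL : ∀ {n} → Graph n → Enumeration n → ℕ
αL G e = maxList (map (degSet G) (linearBinaryTree e))

LOptimal : ∀ {n} → Graph n → Enumeration n → Set
LOptimal {n} G e = (e' : Enumeration n) → αL G e ≤ αL G e'

swap01 : ∀ {n} → Fin n → Fin n
swap01 {suc (suc m)} zero       = suc zero
swap01 {suc (suc m)} (suc zero) = zero
swap01 i = i

-- e' is an enumeration of the linear binary tree given by e
-- (the enumeration is determined by L up to swapping v₁ and v₂).
IsEnumOf : ∀ {n} → Enumeration n → Enumeration n → Set
IsEnumOf e' e = (∀ i → e' ⟨$⟩ʳ i ≡ e ⟨$⟩ʳ i) ⊎ (∀ i → e' ⟨$⟩ʳ i ≡ e ⟨$⟩ʳ swap01 i)

-- φ : V → positions (0-based: position i+1 of the paper is i here)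
Arrangement : ℕ → Set
Arrangement n = Permutation′ n

αA : ∀ {n} → Graph n → Arrangement n → ℕ
αA {n} G φ =
  maxList (applyUpTo (λ j → degSet G (λ v → toℕ (φ ⟨$⟩ʳ v) <ᵇ suc j)) n)

AOptimal : ∀ {n} → Graph n → Arrangement n → Set
AOptimal {n} G φ = (φ' : Arrangement n) → αA G φ ≤ αA G φ'

arrEnum : ∀ {n} → Arrangement n → Enumeration n
arrEnum φ = Data.Fin.Permutation.flip φ

ReassemblingInducedBy : ∀ {n} → Arrangement n → Enumeration n → Set
ReassemblingInducedBy φ e = IsEnumOf (arrEnum φ) e

FirstTwoOrdered : ∀ {n} → Graph n → Enumeration n → Set
FirstTwoOrdered {suc (suc m)} G v = deg G (v ⟨$⟩ʳ zero) ≤ deg G (v ⟨$⟩ʳ suc zero)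
FirstTwoOrdered _ _ = ⊤

-- (G, φ) is the linear arrangement induced by (G, L): φ(v_i) = i for i ≥ 3 and
-- {φ(v₁), φ(v₂)} = {1,2} with one of v₁,v₂ of smaller (or tied) degree at position 1.
-- Equivalently: φ⁻¹ is an enumeration of L whose first vertex has degree ≤ the second's.
ArrangementInducedBy : ∀ {n} → Graph n → Enumeration n → Arrangement n → Set
ArrangementInducedBy G e φ = IsEnumOf (arrEnum φ) e × FirstTwoOrdered G (arrEnum φ)

module Submission where

-- Both α values are maxima over the same prefix sets of size ≥ 2 (swapping the first two
-- vertices does not change them), taken together with all vertex degrees for L and with the
-- degree of the first vertex for φ. These extra terms are ≤ 3, so they are absorbed as soon
-- as every enumeration has width ≥ 3. That width bound is the heart of the proof: if the
-- prefixes just before and just after v both had degree ≤ 2, counting edges shows that the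
-- earlier prefix meets the rest of G only through v while v has neighbours on both sides,
-- so v would be a cut vertex.

open import Defs hiding (sym)
open import Data.Nat using (ℕ; zero; suc; _+_; _∸_; _⊔_; _≤_; _<_; _≤?_; z≤n; s≤s; _<ᵇ_)
open import Data.Nat.Properties
  using ( ≤-refl; ≤-trans; ≤-antisym; <-irrefl; <-cmp; ≤-pred; <⇒≱; ≰⇒>; n≤1+n; n<1+n
        ; m≤n⇒m≤1+n; m≤m+n; m≤n+m; +-mono-≤; +-cancelʳ-≤; +-comm
        ; +-identityʳ; m∸n+n≡m; m≤m⊔n; m≤n⊔m; ⊔-lub; ⊔-mono-≤; ⊔-assoc
        ; <ᵇ⇒<; <⇒<ᵇ; m+n≤o⇒n≤o; <⇒≤; +-commutativeSemigroup )
open import Algebra.Properties.CommutativeSemigroup +-commutativeSemigroup using (interchange)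
open import Data.Bool using (Bool; true; false; _∧_; _∨_; not; if_then_else_)
open import Data.Bool.Properties using (T-≡; ∨-identityʳ; ∨-zeroʳ)
import Data.Bool.Properties as Bool
open import Data.Fin using (Fin; zero; suc; toℕ; _≟_)
open import Data.Fin.Properties using (toℕ-injective; toℕ<n; all?; ¬∀⟶∃¬)
open import Data.Fin.Permutation using (_⟨$⟩ʳ_; _⟨$⟩ˡ_; flip; inverseˡ; inverseʳ)
open import Data.List using (List; []; _∷_; _++_; map; allFin; applyUpTo)
open import Data.List.Properties using (map-tabulate; map-cong; map-++; map-applyUpTo; map-∘)
open import Data.List.Relation.Unary.Any using (here; there; satisfied)
open import Data.List.Relation.Unary.Any.Properties using (any⁺; any⁻)
open import Data.List.Membership.Propositional using (_∈_; lose)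
open import Data.List.Membership.Propositional.Properties using (∈-allFin; ∈-map⁺; ∈-applyUpTo⁺)
open import Data.Bool.ListAction using (any)
open import Data.Nat.ListAction using (sum)
open import Data.Product using (Σ; _×_; _,_; proj₁; proj₂)
open import Data.Sum using (_⊎_; inj₁; inj₂; [_,_])
open import Data.Empty using (⊥; ⊥-elim)
open import Relation.Nullary using (¬_; Dec; yes; no)
open import Relation.Nullary.Decidable using (⌊_⌋; toWitness; fromWitness)
open import Relation.Binary using (tri<; tri≈; tri>)
open import Relation.Binary.PropositionalEquality
  using (_≡_; _≢_; refl; sym; trans; cong; cong₂; subst; subst₂; module ≡-Reasoning)
open import Function using (_∘_; id)
open import Function.Bundles using (_⇔_; mk⇔; Equivalence)

⟦_⟧ : Bool → ℕ
⟦ b ⟧ = if b then 1 else 0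

⟦⟧≤1 : ∀ b → ⟦ b ⟧ ≤ 1
⟦⟧≤1 true  = ≤-refl
⟦⟧≤1 false = z≤n

count : ∀ {n} → VSet n → ℕ
count P = sumV (λ w → ⟦ P w ⟧)

sumV-suc : ∀ {n} (f : Fin (suc n) → ℕ) → sumV f ≡ f zero + sumV (f ∘ suc)
sumV-suc {n} f = cong (λ l → f zero + sum l)
  (trans (map-tabulate suc f) (sym (map-tabulate id (f ∘ suc))))

sumV-cong : ∀ {n} {f g : Fin n → ℕ} → (∀ x → f x ≡ g x) → sumV f ≡ sumV g
sumV-cong {n} h = cong sum (map-cong h (allFin n))

sumV-mono : ∀ {n} {f g : Fin n → ℕ} → (∀ x → f x ≤ g x) → sumV f ≤ sumV g
sumV-mono {zero}  h = z≤n
sumV-mono {suc n} {f} {g} h rewrite sumV-suc f | sumV-suc g =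
  +-mono-≤ (h zero) (sumV-mono (h ∘ suc))

sumV-+ : ∀ {n} (f g : Fin n → ℕ) → sumV (λ x → f x + g x) ≡ sumV f + sumV g
sumV-+ {zero}  f g = refl
sumV-+ {suc n} f g = begin
  sumV (λ x → f x + g x)
    ≡⟨ sumV-suc (λ x → f x + g x) ⟩
  (f zero + g zero) + sumV (λ x → f (suc x) + g (suc x))
    ≡⟨ cong (f zero + g zero +_) (sumV-+ (f ∘ suc) (g ∘ suc)) ⟩
  (f zero + g zero) + (sumV (f ∘ suc) + sumV (g ∘ suc))
    ≡⟨ interchange (f zero) (g zero) _ _ ⟩
  (f zero + sumV (f ∘ suc)) + (g zero + sumV (g ∘ suc))
    ≡⟨ sym (cong₂ _+_ (sumV-suc f) (sumV-suc g)) ⟩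
  sumV f + sumV g ∎
  where open ≡-Reasoning

sumV-swap : ∀ {n} (h : Fin n → Fin n → ℕ) →
  sumV (λ u → sumV (λ w → h u w)) ≡ sumV (λ w → sumV (λ u → h u w))
sumV-swap {zero}  h = refl
sumV-swap {suc n} h = begin
  sumV (λ u → sumV (h u))                  ≡⟨ peel h ⟩
  (h zero zero + a) + (b + sumV (λ u → sumV (λ w → h (suc u) (suc w))))
    ≡⟨ cong (λ s → h zero zero + a + (b + s)) (sumV-swap (λ u w → h (suc u) (suc w))) ⟩
  (h zero zero + a) + (b + sumV (λ w → sumV (λ u → h (suc u) (suc w))))
    ≡⟨ interchange (h zero zero) a b _ ⟩
  (h zero zero + b) + (a + sumV (λ w → sumV (λ u → h (suc u) (suc w))))
    ≡⟨ sym (peel (λ w u → h u w)) ⟩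
  sumV (λ w → sumV (λ u → h u w))          ∎
  where
  open ≡-Reasoning
  a = sumV (λ w → h zero (suc w))
  b = sumV (λ u → h (suc u) zero)
  peel : (g : Fin (suc n) → Fin (suc n) → ℕ) →
    sumV (λ u → sumV (g u)) ≡
    (g zero zero + sumV (λ w → g zero (suc w))) +
    (sumV (λ u → g (suc u) zero) + sumV (λ u → sumV (λ w → g (suc u) (suc w))))
  peel g = trans (sumV-suc (λ u → sumV (g u)))
    (cong₂ _+_ (sumV-suc (g zero))
      (trans (sumV-cong (λ u → sumV-suc (g (suc u))))
             (sumV-+ (λ u → g (suc u) zero) (λ u → sumV (λ w → g (suc u) (suc w))))))

sumV-term : ∀ {n} (f : Fin n → ℕ) v → f v ≤ sumV f
sumV-term {suc n} f zero    rewrite sumV-suc f = m≤m+n (f zero) _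
sumV-term {suc n} f (suc v) rewrite sumV-suc f = ≤-trans (sumV-term (f ∘ suc) v) (m≤n+m _ (f zero))

sumV-positive : ∀ {n} (f : Fin n → ℕ) → 0 < sumV f → Σ (Fin n) (λ v → 0 < f v)
sumV-positive {zero}  f ()
sumV-positive {suc n} f pos with positive-+ (f zero) _ (subst (0 <_) (sumV-suc f) pos)
  where
  positive-+ : ∀ a b → 0 < a + b → 0 < a ⊎ 0 < b
  positive-+ (suc a) b _   = inj₁ (s≤s z≤n)
  positive-+ zero    b a+b = inj₂ a+b
... | inj₁ p = zero , p
... | inj₂ p with sumV-positive (f ∘ suc) p
...   | v , q = suc v , q

count-≤ : ∀ {n} (P : VSet n) → count P ≤ n
count-≤ {zero}  P = z≤n
count-≤ {suc n} P rewrite sumV-suc (λ w → ⟦ P w ⟧) = +-mono-≤ (⟦⟧≤1 (P zero)) (count-≤ (P ∘ suc))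

count-empty : ∀ {n} (P : VSet n) → (∀ w → P w ≡ false) → count P ≡ 0
count-empty {zero}  P h = refl
count-empty {suc n} P h rewrite sumV-suc (λ w → ⟦ P w ⟧) | h zero = count-empty (P ∘ suc) (h ∘ suc)

count-singleton : ∀ {n} (v : Fin n) → count (singleton v) ≡ 1
count-singleton {suc n} zero = trans (sumV-suc {n} (λ w → ⟦ singleton zero w ⟧))
  (cong suc (count-empty {n} (λ w → singleton zero (suc w)) (λ w → refl)))
count-singleton {suc n} (suc v) = trans (sumV-suc {n} (λ w → ⟦ singleton (suc v) w ⟧))
  (trans (sumV-cong {n} {f = λ w → ⟦ singleton (suc v) (suc w) ⟧} (λ w → cong ⟦_⟧ (suc-≟ w v)))
         (count-singleton v))
  where
  suc-≟ : ∀ {m} (w v : Fin m) → ⌊ suc w ≟ suc v ⌋ ≡ ⌊ w ≟ v ⌋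
  suc-≟ w v with w ≟ v
  ... | yes _ = refl
  ... | no  _ = refl

sumV-split-≤ : ∀ {n} {f g h : Fin n → ℕ} → (∀ x → f x + g x ≤ h x) → sumV f + sumV g ≤ sumV h
sumV-split-≤ {f = f} {g} H = subst (_≤ _) (sumV-+ f g) (sumV-mono H)

sumV-split-≥ : ∀ {n} {f g h : Fin n → ℕ} → (∀ x → h x ≤ f x + g x) → sumV h ≤ sumV f + sumV g
sumV-split-≥ {f = f} {g} H = subst (_ ≤_) (sumV-+ f g) (sumV-mono H)

∧-true : ∀ {a b} → (a ∧ b) ≡ true → a ≡ true × b ≡ true
∧-true {true} {true} _ = refl , refl

∧-intro : ∀ {a b} → a ≡ true → b ≡ true → (a ∧ b) ≡ true
∧-intro refl refl = refl

∨-true : ∀ {a b} → (a ∨ b) ≡ true → a ≡ true ⊎ b ≡ true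
∨-true {true}  _ = inj₁ refl
∨-true {false} h = inj₂ h

⟦⟧-mono : ∀ {a b} → (a ≡ true → b ≡ true) → ⟦ a ⟧ ≤ ⟦ b ⟧
⟦⟧-mono {true}  h rewrite h refl = ≤-refl
⟦⟧-mono {false} h = z≤n

⟦⟧-positive : ∀ {b} → 0 < ⟦ b ⟧ → b ≡ true
⟦⟧-positive {true} _ = refl

guard-≤ : ∀ g {p q r} → ⟦ p ⟧ + ⟦ q ⟧ ≤ ⟦ r ⟧ → ⟦ g ∧ p ⟧ + ⟦ g ∧ q ⟧ ≤ ⟦ g ∧ r ⟧
guard-≤ true  h = h
guard-≤ false h = z≤n

guard-≥ : ∀ g {p q r} → ⟦ r ⟧ ≤ ⟦ p ⟧ + ⟦ q ⟧ → ⟦ g ∧ r ⟧ ≤ ⟦ g ∧ p ⟧ + ⟦ g ∧ q ⟧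
guard-≥ true  h = h
guard-≥ false h = z≤n

count-strict-mono : ∀ {n} {P Q : VSet n} (z : Fin n) → (∀ w → P w ≡ true → Q w ≡ true) →
  P z ≡ false → Q z ≡ true → count P < count Q
count-strict-mono {n} {P} {Q} z P⊆Q Pz Qz =
  subst (_≤ count Q) (trans (cong (count P +_) (count-singleton z)) (+-comm (count P) 1))
    (sumV-split-≤ pointwise)
  where
  pointwise : ∀ w → ⟦ P w ⟧ + ⟦ singleton z w ⟧ ≤ ⟦ Q w ⟧
  pointwise w with w ≟ z
  ... | yes refl rewrite Pz | Qz = ≤-refl
  ... | no  _    = subst (_≤ ⟦ Q w ⟧) (sym (+-identityʳ _)) (⟦⟧-mono (P⊆Q w))

count-exchange : ∀ {n} {P Q : VSet n} (v x y : Fin n) → x ≢ y →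
  (∀ w → w ≢ v → P w ≡ true → Q w ≡ true) →
  P x ≡ false → Q x ≡ true → P y ≡ false → Q y ≡ true → count P < count Q
count-exchange {n} {P} {Q} v x y x≢y P⊆Q Px Qx Py Qy =
  +-cancelʳ-≤ 1 (suc (count P)) (count Q) (subst₂ _≤_ lhs rhs (sumV-mono pointwise))
  where
  open ≡-Reasoning
  lhs : sumV (λ w → ⟦ P w ⟧ + ⟦ singleton x w ⟧ + ⟦ singleton y w ⟧) ≡ suc (count P) + 1
  lhs = begin
    sumV (λ w → ⟦ P w ⟧ + ⟦ singleton x w ⟧ + ⟦ singleton y w ⟧)
      ≡⟨ trans (sumV-+ {n} _ (λ w → ⟦ singleton y w ⟧)) (cong (_+ count (singleton y)) (sumV-+ {n} _ _)) ⟩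
    count P + count (singleton x) + count (singleton y)
      ≡⟨ cong₂ (λ a b → count P + a + b) (count-singleton x) (count-singleton y) ⟩
    count P + 1 + 1
      ≡⟨ cong (_+ 1) (+-comm (count P) 1) ⟩
    suc (count P) + 1 ∎
  rhs : sumV (λ w → ⟦ Q w ⟧ + ⟦ singleton v w ⟧) ≡ count Q + 1
  rhs = trans (sumV-+ {n} _ _) (cong (count Q +_) (count-singleton v))
  pointwise : ∀ w → ⟦ P w ⟧ + ⟦ singleton x w ⟧ + ⟦ singleton y w ⟧ ≤ ⟦ Q w ⟧ + ⟦ singleton v w ⟧
  pointwise w with w ≟ x | w ≟ y
  ... | yes refl | yes refl = ⊥-elim (x≢y refl)
  ... | yes refl | no _ rewrite Px | Qx = s≤s z≤n
  ... | no _ | yes refl rewrite Py | Qy = s≤s z≤n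
  ... | no _ | no _ with w ≟ v
  ...   | yes _  = subst (_≤ ⟦ Q w ⟧ + 1) (sym (trans (+-identityʳ _) (+-identityʳ _)))
                         (≤-trans (⟦⟧≤1 (P w)) (m≤n+m 1 ⟦ Q w ⟧))
  ...   | no w≢v = subst₂ _≤_ (sym (trans (+-identityʳ _) (+-identityʳ _))) (sym (+-identityʳ _))
                          (⟦⟧-mono (P⊆Q w w≢v))

-- The number of edges {u,w} with u ∈ X and w ∈ Y, counted as ordered pairs.
-- In particular degSet G X is, by definition, edges G X (complement of X).
edges : ∀ {n} → Graph n → VSet n → VSet n → ℕ
edges G X Y = sumV (λ u → sumV (λ w → ⟦ adj G u w ∧ X u ∧ Y w ⟧))

edges-sym : ∀ {n} (G : Graph n) (X Y : VSet n) → edges G X Y ≡ edges G Y X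
edges-sym G X Y = trans (sumV-swap (λ u w → ⟦ adj G u w ∧ X u ∧ Y w ⟧))
  (sumV-cong (λ w → sumV-cong (λ u → flipEdge u w)))
  where
  flipEdge : ∀ u w → ⟦ adj G u w ∧ X u ∧ Y w ⟧ ≡ ⟦ adj G w u ∧ Y w ∧ X u ⟧
  flipEdge u w rewrite Graph.sym G u w = cong (λ b → ⟦ adj G w u ∧ b ⟧) (Bool.∧-comm (X u) (Y w))

edges-disjointʳ : ∀ {n} (G : Graph n) (X : VSet n) {Y₁ Y₂ Y : VSet n} →
  (∀ w → ⟦ Y₁ w ⟧ + ⟦ Y₂ w ⟧ ≤ ⟦ Y w ⟧) → edges G X Y₁ + edges G X Y₂ ≤ edges G X Y
edges-disjointʳ G X H =
  sumV-split-≤ (λ u → sumV-split-≤ (λ w → guard-≤ (adj G u w) (guard-≤ (X u) (H w))))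

edges-disjointˡ : ∀ {n} (G : Graph n) {X₁ X₂ X : VSet n} (Y : VSet n) →
  (∀ u → ⟦ X₁ u ⟧ + ⟦ X₂ u ⟧ ≤ ⟦ X u ⟧) → edges G X₁ Y + edges G X₂ Y ≤ edges G X Y
edges-disjointˡ G {X₁} {X₂} {X} Y H =
  subst₂ _≤_ (cong₂ _+_ (edges-sym G Y X₁) (edges-sym G Y X₂)) (edges-sym G Y X)
    (edges-disjointʳ G Y H)

edges-coverʳ : ∀ {n} (G : Graph n) (X : VSet n) {Y₁ Y₂ Y : VSet n} →
  (∀ w → ⟦ Y w ⟧ ≤ ⟦ Y₁ w ⟧ + ⟦ Y₂ w ⟧) → edges G X Y ≤ edges G X Y₁ + edges G X Y₂
edges-coverʳ G X H =
  sumV-split-≥ (λ u → sumV-split-≥ (λ w → guard-≥ (adj G u w) (guard-≥ (X u) (H w))))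

edges-witness : ∀ {n} (G : Graph n) (X Y : VSet n) → 0 < edges G X Y →
  Σ (Fin n) λ u → Σ (Fin n) λ w → adj G u w ≡ true × X u ≡ true × Y w ≡ true
edges-witness G X Y pos with sumV-positive _ pos
... | u , inner with sumV-positive _ inner
...   | w , e with ∧-true (⟦⟧-positive e)
...     | a , uw = u , w , a , ∧-true uw

edges-none : ∀ {n} (G : Graph n) (X Y : VSet n) → edges G X Y ≡ 0 →
  ∀ u w → adj G u w ≡ true → X u ≡ true → Y w ≡ true → ⊥
edges-none G X Y none u w a Xu Yw = <-irrefl refl (subst (0 <_) none (begin
  1                                           ≡⟨ cong ⟦_⟧ (sym (∧-intro a (∧-intro Xu Yw))) ⟩
  ⟦ adj G u w ∧ X u ∧ Y w ⟧                    ≤⟨ sumV-term _ w ⟩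
  sumV (λ w → ⟦ adj G u w ∧ X u ∧ Y w ⟧)       ≤⟨ sumV-term _ u ⟩
  edges G X Y                                 ∎))
  where open Data.Nat.Properties.≤-Reasoning

any-witness : ∀ {n} (p : Fin n → Bool) → any p (allFin n) ≡ true → Σ (Fin n) (λ x → p x ≡ true)
any-witness {n} p h with satisfied (any⁻ p (allFin n) (Equivalence.from T-≡ h))
... | x , px = x , Equivalence.to T-≡ px

any-intro : ∀ {n} (p : Fin n → Bool) x → p x ≡ true → any p (allFin n) ≡ true
any-intro p x px = Equivalence.to T-≡ (any⁺ p (lose (∈-allFin x) (Equivalence.from T-≡ px)))

≟-sound : ∀ {n} {u w : Fin n} → ⌊ u ≟ w ⌋ ≡ true → u ≡ w
≟-sound h = toWitness (Equivalence.from T-≡ h)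

≟-refl : ∀ {n} (u : Fin n) → ⌊ u ≟ u ⌋ ≡ true
≟-refl u = Equivalence.to T-≡ (fromWitness refl)

<ᵇ-sound : ∀ {m k} → (m <ᵇ k) ≡ true → m < k
<ᵇ-sound {m} {k} h = <ᵇ⇒< m k (Equivalence.from T-≡ h)

<ᵇ-complete : ∀ {m k} → m < k → (m <ᵇ k) ≡ true
<ᵇ-complete lt = Equivalence.to T-≡ (<⇒<ᵇ lt)

∨-introʳ : ∀ a {b} → b ≡ true → (a ∨ b) ≡ true
∨-introʳ true  _ = refl
∨-introʳ false h = h

newly-true : ∀ {a b} → (a ≡ true → b ≡ true) → b ≢ a → a ≡ false × b ≡ true
newly-true {true}          a⇒b b≢a = ⊥-elim (b≢a (a⇒b refl))
newly-true {false} {true}  _   _   = refl , refl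
newly-true {false} {false} _   b≢a = ⊥-elim (b≢a refl)

module Walks {n : ℕ} (G : Graph n) (X : VSet n) where

  walk : ℕ → Fin n → Fin n → Bool
  walk = reachIter G X

  walk-ends : ∀ k {u w} → walk k u w ≡ true → X u ≡ true × X w ≡ true
  walk-ends zero h with ∧-true h
  ... | u≡w , Xu = Xu , subst (λ t → X t ≡ true) (≟-sound u≡w) Xu
  walk-ends (suc k) {u} {w} h with ∨-true h
  ... | inj₁ h′ = walk-ends k h′
  ... | inj₂ h′ with any-witness (λ x → walk k u x ∧ adj G x w ∧ X w) h′
  ...   | x , p with ∧-true p
  ...     | ux , q = proj₁ (walk-ends k ux) , proj₂ (∧-true q)

  walk-suc : ∀ k {u w} → walk k u w ≡ true → walk (suc k) u w ≡ true
  walk-suc k h rewrite h = refl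

  walk-weaken : ∀ d {k u w} → walk k u w ≡ true → walk (d + k) u w ≡ true
  walk-weaken zero    h = h
  walk-weaken (suc d) {k} h = walk-suc (d + k) (walk-weaken d h)

  walk-refl : ∀ {u} → X u ≡ true → walk 0 u u ≡ true
  walk-refl {u} Xu = ∧-intro (≟-refl u) Xu

  walk-step : ∀ k {u x w} → walk k u x ≡ true → adj G x w ≡ true → X w ≡ true →
    walk (suc k) u w ≡ true
  walk-step k {u} {x} {w} ux a Xw =
    ∨-introʳ (walk k u w) (any-intro _ x (∧-intro ux (∧-intro a Xw)))

  walk-edge : ∀ {x w} → adj G x w ≡ true → X x ≡ true → X w ≡ true → walk 1 x w ≡ true
  walk-edge a Xx Xw = walk-step 0 (walk-refl Xx) a Xw

  walk-closed : (C : Fin n → Set) {u : Fin n} → C u →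
    (∀ {x w} → C x → X x ≡ true → adj G x w ≡ true → X w ≡ true → C w) →
    ∀ k {w} → walk k u w ≡ true → C w
  walk-closed C Cu closed zero h = subst C (≟-sound (proj₁ (∧-true h))) Cu
  walk-closed C {u} Cu closed (suc k) {w} h with ∨-true h
  ... | inj₁ h′ = walk-closed C Cu closed k h′
  ... | inj₂ h′ with any-witness (λ x → walk k u x ∧ adj G x w ∧ X w) h′
  ...   | x , p with ∧-true p
  ...     | ux , q with ∧-true q
  ...       | a , Xw = closed (walk-closed C Cu closed k ux) (proj₂ (walk-ends k ux)) a Xw

  walk-append : ∀ j k {u x w} → walk k u x ≡ true → walk j x w ≡ true → walk (j + k) u w ≡ true
  walk-append zero    k {u} ux xw = subst (λ t → walk k u t ≡ true) (≟-sound (proj₁ (∧-true xw))) ux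
  walk-append (suc j) k {u} {x} {w} ux xw with ∨-true xw
  ... | inj₁ h = walk-suc (j + k) (walk-append j k ux h)
  ... | inj₂ h with any-witness (λ y → walk j x y ∧ adj G y w ∧ X w) h
  ...   | y , p with ∧-true p
  ...     | xy , q with ∧-true q
  ...       | a , Xw = walk-step (j + k) (walk-append j k ux xy) a Xw

  walk-reverse : ∀ k {u w} → walk k u w ≡ true → walk k w u ≡ true
  walk-reverse zero {u} h with ∧-true h
  ... | u≡w , Xu = subst (λ t → walk 0 t u ≡ true) (≟-sound u≡w) (walk-refl Xu)
  walk-reverse (suc k) {u} {w} h with ∨-true h
  ... | inj₁ h′ = walk-suc k (walk-reverse k h′)
  ... | inj₂ h′ with any-witness (λ x → walk k u x ∧ adj G x w ∧ X w) h′
  ...   | x , p with ∧-true p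
  ...     | ux , q with ∧-true q
  ...       | a , Xw = subst (λ t → walk t w u ≡ true) (+-comm k 1)
                (walk-append k 1 (walk-edge (trans (Graph.sym G w x) a) Xw (proj₂ (walk-ends k ux)))
                               (walk-reverse k ux))

  Stable : Fin n → ℕ → Set
  Stable u k = ∀ w → walk (suc k) u w ≡ walk k u w

  stable-final : ∀ {u k} → Stable u k → X u ≡ true → ∀ j {w} → walk j u w ≡ true → walk k u w ≡ true
  stable-final {u} {k} stable Xu =
    walk-closed (λ w → walk k u w ≡ true)
      (subst (λ t → walk t u u ≡ true) (+-identityʳ k) (walk-weaken k (walk-refl Xu)))
      (λ ux _ a Xw → trans (sym (stable _)) (walk-step k ux a Xw))

  -- Each unstable step reaches a new vertex, so by step k either the walks from u
  -- have stabilised or they reach at least k+1 vertices.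
  stabilises-or-grows : ∀ {u} → X u ≡ true → ∀ k →
    Σ ℕ (λ j → j ≤ k × Stable u j) ⊎ suc k ≤ count (walk k u)
  stabilises-or-grows {u} Xu zero =
    inj₂ (subst (_≤ count (walk 0 u)) (cong ⟦_⟧ (walk-refl Xu)) (sumV-term _ u))
  stabilises-or-grows {u} Xu (suc k) with stabilises-or-grows Xu k
  ... | inj₁ (j , j≤k , stable) = inj₁ (j , m≤n⇒m≤1+n j≤k , stable)
  ... | inj₂ grown with all? (λ w → walk (suc k) u w Bool.≟ walk k u w)
  ...   | yes stable = inj₁ (k , n≤1+n k , stable)
  ...   | no unstable with ¬∀⟶∃¬ n _ (λ w → walk (suc k) u w Bool.≟ walk k u w) unstable
  ...     | w , differs with newly-true (walk-suc k {u} {w}) differs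
  ...       | old , new =
    inj₂ (≤-trans (s≤s grown) (count-strict-mono w (λ w′ → walk-suc k {u} {w′}) old new))

  saturation : ∀ k {u w} → walk k u w ≡ true → walk n u w ≡ true
  saturation k {u} {w} h with stabilises-or-grows (proj₁ (walk-ends k h)) n
  ... | inj₂ grown = ⊥-elim (<⇒≱ grown (count-≤ (walk n u)))
  ... | inj₁ (j , j≤n , stable) = subst (λ t → walk t u w ≡ true) (m∸n+n≡m j≤n)
          (walk-weaken (n ∸ j) {j} (stable-final {u} {j} stable (proj₁ (walk-ends k h)) k h))

  reach-ends : ∀ {u w} → reach G X u w ≡ true → X u ≡ true × X w ≡ true
  reach-ends = walk-ends n

  reach-refl : ∀ {u} → X u ≡ true → reach G X u u ≡ true
  reach-refl Xu = saturation 0 (walk-refl Xu)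

  reach-edge : ∀ {x w} → adj G x w ≡ true → X x ≡ true → X w ≡ true → reach G X x w ≡ true
  reach-edge a Xx Xw = saturation 1 (walk-edge a Xx Xw)

  reach-sym : ∀ {u w} → reach G X u w ≡ true → reach G X w u ≡ true
  reach-sym = walk-reverse n

  reach-trans : ∀ {u x w} → reach G X u x ≡ true → reach G X x w ≡ true → reach G X u w ≡ true
  reach-trans ux xw = saturation (n + n) (walk-append n n ux xw)

  reach-invariant : (c : Fin n → Bool) →
    (∀ {x w} → X x ≡ true → adj G x w ≡ true → X w ≡ true → c x ≡ c w) →
    ∀ {u w} → reach G X u w ≡ true → c u ≡ c w
  reach-invariant c preserved {u} =
    walk-closed (λ w → c u ≡ c w) refl (λ cx Xx a Xw → trans cx (preserved Xx a Xw)) n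

open Walks using (reach-ends; reach-refl; reach-edge; reach-sym; reach-trans; reach-invariant)

reach-mono : ∀ {n} (G : Graph n) {X Y : VSet n} → (∀ w → X w ≡ true → Y w ≡ true) →
  ∀ k {u w} → reachIter G X k u w ≡ true → reachIter G Y k u w ≡ true
reach-mono G X⊆Y zero h with ∧-true h
... | u≡w , Xu = ∧-intro u≡w (X⊆Y _ Xu)
reach-mono G {X} {Y} X⊆Y (suc k) {u} {w} h with ∨-true h
... | inj₁ h′ rewrite reach-mono G X⊆Y k h′ = refl
... | inj₂ h′ with any-witness (λ x → reachIter G X k u x ∧ adj G x w ∧ X w) h′
...   | x , p with ∧-true p
...     | ux , q with ∧-true q
...       | a , Xw = Walks.walk-step G Y k (reach-mono G X⊆Y k ux) a (X⊆Y w Xw)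

true≢false : ∀ {b} → b ≡ true → b ≡ false → ⊥
true≢false refl ()

-- `leader G X w`: w lies in X and is the least (by index) vertex of its component of G[X].
-- By definition, numComponents G X is the number of leaders.
leader : ∀ {n} → Graph n → VSet n → Fin n → Bool
leader {n} G X w = X w ∧ not (any (λ u → (toℕ u <ᵇ toℕ w) ∧ reach G X u w) (allFin n))

leader-earlier : ∀ {n} (G : Graph n) (X : VSet n) {u w} →
  toℕ u < toℕ w → reach G X u w ≡ true → leader G X w ≡ false
leader-earlier G X {u} {w} u<w uw
  rewrite any-intro (λ u → (toℕ u <ᵇ toℕ w) ∧ reach G X u w) u (∧-intro (<ᵇ-complete u<w) uw) =
  Bool.∧-zeroʳ (X w)

leader-pair : ∀ {n} (G : Graph n) (X : VSet n) {x y} → x ≢ y → reach G X x y ≡ true →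
  leader G X x ≡ false ⊎ leader G X y ≡ false
leader-pair G X {x} {y} x≢y xy with <-cmp (toℕ x) (toℕ y)
... | tri< x<y _ _ = inj₂ (leader-earlier G X x<y xy)
... | tri≈ _ x≡y _ = ⊥-elim (x≢y (toℕ-injective x≡y))
... | tri> _ _ y<x = inj₁ (leader-earlier G X y<x (reach-sym G X xy))

-- Every vertex of X is reachable from a leader: follow earlier vertices down to the least one.
leader-exists : ∀ {n} (G : Graph n) (X : VSet n) {w} → X w ≡ true →
  Σ (Fin n) λ x → leader G X x ≡ true × reach G X x w ≡ true
leader-exists {n} G X {w} Xw = descend (suc (toℕ w)) w ≤-refl (reach-refl G X Xw)
  where
  earlier-exists : ∀ {a b} → a ≡ true → (a ∧ not b) ≡ false → b ≡ true
  earlier-exists {b = true} refl _ = refl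
  descend : ∀ fuel x → toℕ x < fuel → reach G X x w ≡ true →
    Σ (Fin n) λ x → leader G X x ≡ true × reach G X x w ≡ true
  descend (suc fuel) x x<fuel xw with leader G X x in is-leader
  ... | true  = x , is-leader , xw
  ... | false with any-witness (λ u → (toℕ u <ᵇ toℕ x) ∧ reach G X u x)
                     (earlier-exists (proj₁ (reach-ends G X xw)) is-leader)
  ...   | u , p with ∧-true p
  ...     | u<x , ux = descend fuel u (≤-trans (<ᵇ-sound u<x) (≤-pred x<fuel)) (reach-trans G X ux xw)

leader-restrict : ∀ {n} (G : Graph n) {X Y : VSet n} → (∀ w → Y w ≡ true → X w ≡ true) →
  ∀ {w} → Y w ≡ true → leader G X w ≡ true → leader G Y w ≡ true
leader-restrict {n} G {X} {Y} Y⊆X {w} Yw is-leader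
  with any (λ u → (toℕ u <ᵇ toℕ w) ∧ reach G Y u w) (allFin n) in earlier
... | false rewrite Yw = refl
... | true with any-witness (λ u → (toℕ u <ᵇ toℕ w) ∧ reach G Y u w) earlier
...   | u , p with ∧-true p
...     | u<w , uw = ⊥-elim (true≢false is-leader
                       (leader-earlier G X (<ᵇ-sound u<w) (reach-mono G Y⊆X n uw)))

without : ∀ {n} → Fin n → VSet n
without v u = not ⌊ u ≟ v ⌋

without-intro : ∀ {n} {u v : Fin n} → u ≢ v → without v u ≡ true
without-intro {u = u} {v} u≢v with u ≟ v
... | yes u≡v = ⊥-elim (u≢v u≡v)
... | no  _   = refl

without-elim : ∀ {n} {u v : Fin n} → without v u ≡ true → u ≢ v
without-elim {u = u} h refl rewrite ≟-refl u = true≢false h refl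

-- The leaders x of a and y of b in G − v lie on different
-- sides of S, hence distinct leaders of G − v; in G they are joined through v, so at most
-- one of x, y, v leads a component of G, while every other leader of G remains one in G − v.
separator⇒cutVertex : ∀ {n} (G : Graph n) (v : Fin n) (S : VSet n) → S v ≡ false →
  (∀ {u w} → adj G u w ≡ true → S u ≡ true → S w ≡ false → w ≡ v) →
  ∀ {a b} → S a ≡ true → adj G a v ≡ true → S b ≡ false → b ≢ v → adj G b v ≡ true →
  IsCutVertex G v
separator⇒cutVertex {n} G v S Sv separates {a} {b} Sa av Sb b≢v bv =
  more-leaders (leader G whole v) refl
  where
  whole : VSet n
  whole _ = true

  -- within G − v, reachability never crosses between S and its complement
  crossing : ∀ {x w} → without v x ≡ true → adj G x w ≡ true → without v w ≡ true → S x ≡ S w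
  crossing {x} {w} x∈ xw w∈ with S x in Sx | S w in Sw
  ... | true  | true  = refl
  ... | false | false = refl
  ... | true  | false = ⊥-elim (without-elim w∈ (separates xw Sx Sw))
  ... | false | true  = ⊥-elim (without-elim x∈ (separates (trans (Graph.sym G w x) xw) Sw Sx))

  side : ∀ {u w} → reach G (without v) u w ≡ true → S u ≡ S w
  side = reach-invariant G (without v) S crossing

  a≢v : a ≢ v
  a≢v refl = true≢false Sa Sv

  x y : Fin n
  x = proj₁ (leader-exists G (without v) (without-intro a≢v))
  y = proj₁ (leader-exists G (without v) (without-intro b≢v))
  leader-x : leader G (without v) x ≡ true
  leader-x = proj₁ (proj₂ (leader-exists G (without v) (without-intro a≢v)))
  leader-y : leader G (without v) y ≡ true
  leader-y = proj₁ (proj₂ (leader-exists G (without v) (without-intro b≢v)))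
  xa : reach G (without v) x a ≡ true
  xa = proj₂ (proj₂ (leader-exists G (without v) (without-intro a≢v)))
  yb : reach G (without v) y b ≡ true
  yb = proj₂ (proj₂ (leader-exists G (without v) (without-intro b≢v)))

  x≢y : x ≢ y
  x≢y x≡y = true≢false (trans (side xa) Sa) (trans (cong S x≡y) (trans (side yb) Sb))

  x≢v : x ≢ v
  x≢v = without-elim (proj₁ (∧-true leader-x))
  y≢v : y ≢ v
  y≢v = without-elim (proj₁ (∧-true leader-y))

  in-G : ∀ {u w} → reach G (without v) u w ≡ true → reach G whole u w ≡ true
  in-G = reach-mono G (λ _ _ → refl) n
  xv : reach G whole x v ≡ true
  xv = reach-trans G whole (in-G xa) (reach-edge G whole av refl refl)
  yv : reach G whole y v ≡ true
  yv = reach-trans G whole (in-G yb) (reach-edge G whole bv refl refl)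

  kept : ∀ w → w ≢ v → leader G whole w ≡ true → leader G (without v) w ≡ true
  kept w w≢v = leader-restrict G (λ _ _ → refl) (without-intro w≢v)

  kept-all : leader G whole v ≡ false →
    ∀ w → leader G whole w ≡ true → leader G (without v) w ≡ true
  kept-all v-lost w = by-cases (w ≟ v)
    where
    by-cases : Dec (w ≡ v) → leader G whole w ≡ true → leader G (without v) w ≡ true
    by-cases (yes refl) v-leader = ⊥-elim (true≢false v-leader v-lost)
    by-cases (no w≢v)            = kept w w≢v

  more-leaders : ∀ b → leader G whole v ≡ b →
    count (leader G whole) < count (leader G (without v))
  more-leaders false v-lost with leader-pair G whole x≢y (reach-trans G whole xv (reach-sym G whole yv))
  ... | inj₁ x-lost = count-strict-mono x (kept-all v-lost) x-lost leader-x
  ... | inj₂ y-lost = count-strict-mono y (kept-all v-lost) y-lost leader-y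
  more-leaders true v-leader =
    count-exchange v x y x≢y kept (lost x≢v xv) leader-x (lost y≢v yv) leader-y
    where
    -- v leads its component of G, so the other vertices of that component do not
    lost : ∀ {z} → z ≢ v → reach G whole z v ≡ true → leader G whole z ≡ false
    lost z≢v zv with leader-pair G whole (z≢v ∘ sym) (reach-sym G whole zv)
    ... | inj₁ v-lost = ⊥-elim (true≢false v-leader v-lost)
    ... | inj₂ z-lost = z-lost

insert : ∀ {n} → VSet n → Fin n → VSet n
insert S v w = S w ∨ ⌊ w ≟ v ⌋

-- The arithmetic core of the next lemma: two cuts of size ≤ 2 around a vertex of degree ≥ 3
-- leave no edge e bypassing it, and force neighbours on both sides.
thin-arithmetic : ∀ s t e → s + e ≤ 2 → t + e ≤ 2 → 3 ≤ s + t → e ≡ 0 × 0 < s × 0 < t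
thin-arithmetic zero t e _ te st = ⊥-elim (<⇒≱ (n<1+n 2) (≤-trans st (≤-trans (m≤m+n t e) te)))
thin-arithmetic (suc s) zero e se _ st = ⊥-elim (<⇒≱ (n<1+n 2)
  (≤-trans (subst (3 ≤_) (+-identityʳ (suc s)) st) (≤-trans (m≤m+n (suc s) e) se)))
thin-arithmetic (suc s) (suc t) zero _ _ _ = refl , s≤s z≤n , s≤s z≤n
thin-arithmetic (suc zero) (suc zero) (suc e) _ _ (s≤s (s≤s ()))
thin-arithmetic (suc (suc s)) (suc t) (suc e) (s≤s (s≤s se)) _ _ with m+n≤o⇒n≤o s se
... | ()
thin-arithmetic (suc zero) (suc (suc t)) (suc e) _ (s≤s (s≤s te)) _ with m+n≤o⇒n≤o t te
... | ()

-- With s and t the numbers of neighbours of v in S and beyond S ∪ {v}, and e the number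
-- of edges from S to beyond S ∪ {v}: deg S ≥ s + e, deg (S ∪ {v}) ≥ t + e and deg v ≤ s + t,
-- so e = 0 and s, t > 0, i.e. S is a separator as in separator⇒cutVertex.
thinCuts⇒cutVertex : ∀ {n} (G : Graph n) (v : Fin n) (S : VSet n) → S v ≡ false →
  3 ≤ deg G v → degSet G S ≤ 2 → degSet G (insert S v) ≤ 2 → IsCutVertex G v
thinCuts⇒cutVertex {n} G v S Sv deg-v thin thin⁺ =
  conclude (thin-arithmetic s t e (≤-trans cut-S thin) (≤-trans cut-S⁺ thin⁺) (≤-trans deg-v deg-split))
  where
  beyond : VSet n
  beyond w = not (insert S v w)
  s t e : ℕ
  s = edges G S (singleton v)
  t = edges G (singleton v) beyond
  e = edges G S beyond
  beyond-intro : ∀ {w} → S w ≡ false → w ≢ v → beyond w ≡ true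
  beyond-intro Sw w≢v rewrite Sw = without-intro w≢v
  beyond-elim : ∀ {w} → beyond w ≡ true → S w ≡ false × w ≢ v
  beyond-elim {w} h with S w
  ... | false = refl , without-elim h
  ... | true  = ⊥-elim (true≢false h refl)
  separates : e ≡ 0 → ∀ {u w} → adj G u w ≡ true → S u ≡ true → S w ≡ false → w ≡ v
  separates e≡0 {u} {w} uw Su Sw with w ≟ v
  ... | yes w≡v = w≡v
  ... | no  w≢v = ⊥-elim (edges-none G S beyond e≡0 u w uw Su (beyond-intro Sw w≢v))
  neighbour-inside : 0 < s → Σ (Fin n) λ a → S a ≡ true × adj G a v ≡ true
  neighbour-inside 0<s with edges-witness G S (singleton v) 0<s
  ... | a , v′ , av′ , Sa , v′≡v = a , Sa , subst (λ z → adj G a z ≡ true) (≟-sound v′≡v) av′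
  neighbour-beyond : 0 < t → Σ (Fin n) λ b → S b ≡ false × b ≢ v × adj G b v ≡ true
  neighbour-beyond 0<t with edges-witness G (singleton v) beyond 0<t
  ... | v′ , b , v′b , v′≡v , beyond-b with beyond-elim beyond-b
  ...   | Sb , b≢v = b , Sb , b≢v ,
                     trans (Graph.sym G b v) (subst (λ z → adj G z b ≡ true) (≟-sound v′≡v) v′b)
  conclude : e ≡ 0 × 0 < s × 0 < t → IsCutVertex G v
  conclude (e≡0 , 0<s , 0<t) with neighbour-inside 0<s | neighbour-beyond 0<t
  ... | a , Sa , av | b , Sb , b≢v , bv = separator⇒cutVertex G v S Sv (separates e≡0) Sa av Sb b≢v bv
  cut-S : s + e ≤ degSet G S
  cut-S = edges-disjointʳ G S pointwise
    where
    pointwise : ∀ w → ⟦ singleton v w ⟧ + ⟦ beyond w ⟧ ≤ ⟦ not (S w) ⟧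
    pointwise w with w ≟ v
    ... | yes refl rewrite Sv = ≤-refl
    ... | no  _ with S w
    ...   | true  = ≤-refl
    ...   | false = ≤-refl
  cut-S⁺ : t + e ≤ degSet G (insert S v)
  cut-S⁺ = edges-disjointˡ G beyond pointwise
    where
    pointwise : ∀ u → ⟦ singleton v u ⟧ + ⟦ S u ⟧ ≤ ⟦ insert S v u ⟧
    pointwise u with u ≟ v
    ... | yes refl rewrite Sv = ≤-refl
    ... | no  _ with S u
    ...   | true  = ≤-refl
    ...   | false = ≤-refl
  deg-split : deg G v ≤ s + t
  deg-split = subst (λ x → deg G v ≤ x + t) (edges-sym G (singleton v) S)
    (edges-coverʳ G (singleton v) pointwise)
    where
    pointwise : ∀ w → ⟦ not (singleton v w) ⟧ ≤ ⟦ S w ⟧ + ⟦ beyond w ⟧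
    pointwise w with w ≟ v
    ... | yes _ = z≤n
    ... | no  _ with S w
    ...   | true  = ≤-refl
    ...   | false = ≤-refl

degSet-cong : ∀ {n} (G : Graph n) {X Y : VSet n} → (∀ w → X w ≡ Y w) → degSet G X ≡ degSet G Y
degSet-cong G X≡Y =
  sumV-cong (λ u → sumV-cong (λ w → cong₂ (λ a b → ⟦ adj G u w ∧ a ∧ not b ⟧) (X≡Y u) (X≡Y w)))

degSet-empty : ∀ {n} (G : Graph n) → degSet G (λ _ → false) ≡ 0
degSet-empty {n} G = trans (sumV-cong (λ u → count-empty _ (λ w → Bool.∧-zeroʳ (adj G u w))))
                           (count-empty {n} (λ _ → false) (λ _ → refl))

maxList-++ : ∀ xs ys → maxList (xs ++ ys) ≡ maxList xs ⊔ maxList ys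
maxList-++ []       ys = refl
maxList-++ (x ∷ xs) ys = trans (cong (x ⊔_) (maxList-++ xs ys)) (sym (⊔-assoc x (maxList xs) (maxList ys)))

maxList-upper : ∀ {x xs} → x ∈ xs → x ≤ maxList xs
maxList-upper {xs = y ∷ ys} (here refl) = m≤m⊔n y (maxList ys)
maxList-upper {xs = y ∷ ys} (there x∈) = ≤-trans (maxList-upper x∈) (m≤n⊔m y (maxList ys))

maxList-map-bound : ∀ {A : Set} (f : A → ℕ) {b} → (∀ x → f x ≤ b) → ∀ xs → maxList (map f xs) ≤ b
maxList-map-bound f f≤b []       = z≤n
maxList-map-bound f f≤b (x ∷ xs) = ⊔-lub (f≤b x) (maxList-map-bound f f≤b xs)

⊔-absorb : ∀ {d m} b → d ≤ m → m ≤ d ⊔ b → m ⊔ b ≡ d ⊔ b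
⊔-absorb b d≤m m≤d⊔b = ≤-antisym (⊔-lub m≤d⊔b (m≤n⊔m _ b)) (⊔-mono-≤ d≤m ≤-refl)

maxDegree : ∀ {n} → Graph n → ℕ
maxDegree {n} G = maxList (map (deg G) (allFin n))

-- The width of an enumeration: the largest degree of its prefix sets of sizes 1, …, n.
-- α(G, φ) is by definition the width of the enumeration φ⁻¹(1), …, φ⁻¹(n).
width : ∀ {n} → Graph n → Enumeration n → ℕ
width {n} G e = maxList (applyUpTo (λ j → degSet G (prefixSet e (suc j))) n)

width-prefix : ∀ {n} (G : Graph n) (e : Enumeration n) j → j < n →
  degSet G (prefixSet e (suc j)) ≤ width G e
width-prefix G e j j<n = maxList-upper (∈-applyUpTo⁺ (λ j → degSet G (prefixSet e (suc j))) j<n)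

<ᵇ-irrefl : ∀ k → (k <ᵇ k) ≡ false
<ᵇ-irrefl zero    = refl
<ᵇ-irrefl (suc k) = <ᵇ-irrefl k

<ᵇ-suc : ∀ {k i} → k ≢ i → (k <ᵇ suc i) ≡ (k <ᵇ i)
<ᵇ-suc {zero}  {zero}  k≢i = ⊥-elim (k≢i refl)
<ᵇ-suc {zero}  {suc i} _   = refl
<ᵇ-suc {suc k} {zero}  _   = refl
<ᵇ-suc {suc k} {suc i} k≢i = <ᵇ-suc (k≢i ∘ cong suc)

prefix-insert : ∀ {n} (e : Enumeration n) (v : Fin n) w →
  prefixSet e (suc (toℕ (e ⟨$⟩ˡ v))) w ≡ insert (prefixSet e (toℕ (e ⟨$⟩ˡ v))) v w
prefix-insert e v w with w ≟ v
... | yes refl = trans (<ᵇ-complete {toℕ (e ⟨$⟩ˡ w)} ≤-refl) (sym (∨-zeroʳ _))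
... | no  w≢v  = trans (<ᵇ-suc (w≢v ∘ position-injective)) (sym (∨-identityʳ _))
  where
  position-injective : toℕ (e ⟨$⟩ˡ w) ≡ toℕ (e ⟨$⟩ˡ v) → w ≡ v
  position-injective eq = begin
    w                        ≡⟨ sym (inverseʳ e) ⟩
    e ⟨$⟩ʳ (e ⟨$⟩ˡ w)         ≡⟨ cong (e ⟨$⟩ʳ_) (toℕ-injective eq) ⟩
    e ⟨$⟩ʳ (e ⟨$⟩ˡ v)         ≡⟨ inverseʳ e ⟩
    v                        ∎
    where open ≡-Reasoning

-- The paper's key observation: around a vertex v of degree 3 that is not a cut vertex,
-- the prefixes just before and just after v cannot both have degree ≤ 2, so every
-- enumeration has width ≥ 3.
width≥3 : ∀ {n} (G : Graph n) (v : Fin n) → deg G v ≡ 3 → ¬ IsCutVertex G v →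
  (e : Enumeration n) → 3 ≤ width G e
width≥3 {n} G v deg-v non-cut e = decide (3 ≤? degSet G S) (3 ≤? degSet G S⁺)
  where
  i : ℕ
  i = toℕ (e ⟨$⟩ˡ v)
  S S⁺ : VSet n
  S  = prefixSet e i
  S⁺ = prefixSet e (suc i)
  thick-prefix : ∀ k → k ≤ n → 3 ≤ degSet G (prefixSet e k) → 3 ≤ width G e
  thick-prefix zero    _   thick = ⊥-elim (<⇒≱ (subst (3 ≤_) (degSet-empty G) thick) z≤n)
  thick-prefix (suc j) k≤n thick = ≤-trans thick (width-prefix G e j k≤n)
  decide : Dec (3 ≤ degSet G S) → Dec (3 ≤ degSet G S⁺) → 3 ≤ width G e
  decide _           (yes thick⁺) = thick-prefix (suc i) (toℕ<n (e ⟨$⟩ˡ v)) thick⁺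
  decide (yes thick) _            = thick-prefix i (<⇒≤ (toℕ<n (e ⟨$⟩ˡ v))) thick
  decide (no thin)   (no thin⁺)   = ⊥-elim (non-cut (thinCuts⇒cutVertex G v S (<ᵇ-irrefl i)
    (subst (3 ≤_) (sym deg-v) ≤-refl) (≤-pred (≰⇒> thin))
    (subst (_≤ 2) (degSet-cong G (prefix-insert e v)) (≤-pred (≰⇒> thin⁺)))))

positions-transfer : ∀ {n} (e e′ : Enumeration n) (f : Fin n → Fin n) →
  (∀ i → e′ ⟨$⟩ʳ i ≡ e ⟨$⟩ʳ f i) → ∀ u → e ⟨$⟩ˡ u ≡ f (e′ ⟨$⟩ˡ u)
positions-transfer e e′ f e′≡e∘f u = begin
  e ⟨$⟩ˡ u                        ≡⟨ cong (e ⟨$⟩ˡ_) (sym (inverseʳ e′)) ⟩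
  e ⟨$⟩ˡ (e′ ⟨$⟩ʳ (e′ ⟨$⟩ˡ u))     ≡⟨ cong (e ⟨$⟩ˡ_) (e′≡e∘f (e′ ⟨$⟩ˡ u)) ⟩
  e ⟨$⟩ˡ (e ⟨$⟩ʳ f (e′ ⟨$⟩ˡ u))    ≡⟨ inverseˡ e ⟩
  f (e′ ⟨$⟩ˡ u)                   ∎
  where open ≡-Reasoning

swap01-prefix : ∀ {n} (i : Fin n) j → (toℕ (swap01 i) <ᵇ 2 + j) ≡ (toℕ i <ᵇ 2 + j)
swap01-prefix {suc (suc m)} zero          j = refl
swap01-prefix {suc (suc m)} (suc zero)    j = refl
swap01-prefix {suc (suc m)} (suc (suc i)) j = refl
swap01-prefix {suc zero}    zero          j = refl

prefix-agree : ∀ {n} {e′ e : Enumeration n} → IsEnumOf e′ e →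
  ∀ j u → prefixSet e (2 + j) u ≡ prefixSet e′ (2 + j) u
prefix-agree {e′ = e′} {e} (inj₁ same) j u =
  cong (λ i → toℕ i <ᵇ 2 + j) (positions-transfer e e′ id same u)
prefix-agree {e′ = e′} {e} (inj₂ swapped) j u =
  trans (cong (λ i → toℕ i <ᵇ 2 + j) (positions-transfer e e′ swap01 swapped u))
        (swap01-prefix (e′ ⟨$⟩ˡ u) j)

prefix-one : ∀ {n} (e : Enumeration (suc n)) u → prefixSet e 1 u ≡ singleton (e ⟨$⟩ʳ zero) u
prefix-one e u with e ⟨$⟩ˡ u in position | u ≟ e ⟨$⟩ʳ zero
... | zero  | yes _ = refl
... | suc _ | no  _ = refl
... | zero  | no u≢first = ⊥-elim (u≢first (trans (sym (inverseʳ e)) (cong (e ⟨$⟩ʳ_) position)))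
... | suc _ | yes refl with () ← trans (sym position) (inverseˡ e)

αL-split : ∀ {m} (G : Graph (suc m)) (e : Enumeration (suc m)) →
  αL G e ≡ maxDegree G ⊔ maxList (applyUpTo (λ j → degSet G (prefixSet e (2 + j))) m)
αL-split {m} G e = begin
  maxList (map (degSet G) (map singleton (allFin (suc m)) ++ prefixes))
    ≡⟨ cong maxList (map-++ (degSet G) (map singleton (allFin (suc m))) prefixes) ⟩
  maxList (map (degSet G) (map singleton (allFin (suc m))) ++ map (degSet G) prefixes)
    ≡⟨ maxList-++ (map (degSet G) (map singleton (allFin (suc m)))) (map (degSet G) prefixes) ⟩
  maxList (map (degSet G) (map singleton (allFin (suc m)))) ⊔ maxList (map (degSet G) prefixes)
    ≡⟨ cong₂ _⊔_ (cong maxList (sym (map-∘ (allFin (suc m)))))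
                 (cong maxList (map-applyUpTo (λ j → prefixSet e (2 + j)) (degSet G) m)) ⟩
  maxDegree G ⊔ maxList (applyUpTo (λ j → degSet G (prefixSet e (2 + j))) m) ∎
  where
  open ≡-Reasoning
  prefixes : List (VSet (suc m))
  prefixes = applyUpTo (λ j → prefixSet e (2 + j)) m

αA-split : ∀ {m} (G : Graph (suc m)) (φ : Arrangement (suc m)) →
  αA G φ ≡ deg G (φ ⟨$⟩ˡ zero) ⊔ maxList (applyUpTo (λ j → degSet G (prefixSet (arrEnum φ) (2 + j))) m)
αA-split {m} G φ = cong (_⊔ maxList (applyUpTo (λ j → degSet G (prefixSet (arrEnum φ) (2 + j))) m))
  (degSet-cong G (prefix-one (arrEnum φ)))

-- For the graphs of the theorem, α(G, L) = α(G, φ) whenever φ⁻¹ enumerates L: both are the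
-- maximum of the common prefix degrees with, respectively, the maximal degree (≤ 3) or the
-- degree of the first vertex, and both maxima are at least the width ≥ 3.
α-agree : ∀ {n} (G : Graph n) → (∀ v → deg G v ≤ 3) →
  Σ (Fin n) (λ v → deg G v ≡ 3 × ¬ IsCutVertex G v) →
  (e : Enumeration n) (φ : Arrangement n) → IsEnumOf (arrEnum φ) e → αL G e ≡ αA G φ
α-agree {zero}  G _     (() , _)
α-agree {suc m} G deg≤3 (v , deg-v , non-cut) e φ same-tree = begin
  αL G e                                ≡⟨ αL-split G e ⟩
  maxDegree G ⊔ prefixes e              ≡⟨ cong (maxDegree G ⊔_) common-prefixes ⟩
  maxDegree G ⊔ prefixes (arrEnum φ)    ≡⟨ ⊔-absorb (prefixes (arrEnum φ)) first≤max max≤α ⟩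
  deg G first ⊔ prefixes (arrEnum φ)    ≡⟨ sym (αA-split G φ) ⟩
  αA G φ                                ∎
  where
  open ≡-Reasoning
  prefixes : Enumeration (suc m) → ℕ
  prefixes e = maxList (applyUpTo (λ j → degSet G (prefixSet e (2 + j))) m)
  first : Fin (suc m)
  first = φ ⟨$⟩ˡ zero
  common-prefixes : prefixes e ≡ prefixes (arrEnum φ)
  common-prefixes = cong maxList
    (applyUpTo-cong (λ j → degSet-cong G (prefix-agree {e′ = arrEnum φ} {e} same-tree j)) m)
    where
    applyUpTo-cong : ∀ {f g : ℕ → ℕ} → (∀ j → f j ≡ g j) → ∀ k → applyUpTo f k ≡ applyUpTo g k
    applyUpTo-cong f≡g zero    = refl
    applyUpTo-cong f≡g (suc k) = cong₂ _∷_ (f≡g 0) (applyUpTo-cong (f≡g ∘ suc) k)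
  first≤max : deg G first ≤ maxDegree G
  first≤max = maxList-upper (∈-map⁺ (deg G) (∈-allFin first))
  max≤α : maxDegree G ≤ deg G first ⊔ prefixes (arrEnum φ)
  max≤α = ≤-trans (maxList-map-bound (deg G) deg≤3 (allFin (suc m)))
         (subst (3 ≤_) (αA-split G φ) (width≥3 G v deg-v non-cut (arrEnum φ)))

-- Lemma 4.5. Every arrangement φ′ and the reassembling it induces have equal α, and every
-- enumeration e′ is induced by the arrangement φ′ = e′⁻¹; so the two α values of the
-- given pair agree, and minimality transfers in both directions.
lemma4p5 : {n : ℕ} (G : Graph n) →
    (∀ v → deg G v ≤ 3) →
    Σ (Fin n) (λ v → deg G v ≡ 3 × ¬ IsCutVertex G v) →
    (e : Enumeration n) (φ : Arrangement n) →
    (ReassemblingInducedBy φ e ⊎ ArrangementInducedBy G e φ) →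
    (αL G e ≡ αA G φ) × (LOptimal G e ⇔ AOptimal G φ)
lemma4p5 G deg≤3 good-vertex e φ induced = agree e φ same-tree , mk⇔ L⇒A A⇒L
  where
  agree : (e : Enumeration _) (φ : Arrangement _) → IsEnumOf (arrEnum φ) e → αL G e ≡ αA G φ
  agree = α-agree G deg≤3 good-vertex
  same-tree : IsEnumOf (arrEnum φ) e
  same-tree = [ id , proj₁ ] induced
  L⇒A : LOptimal G e → AOptimal G φ
  L⇒A optimal φ′ = subst₂ _≤_ (agree e φ same-tree) (agree (arrEnum φ′) φ′ (inj₁ (λ _ → refl)))
                     (optimal (arrEnum φ′))
  A⇒L : AOptimal G φ → LOptimal G e
  A⇒L optimal e′ = subst₂ _≤_ (sym (agree e φ same-tree)) (sym (agree e′ (flip e′) (inj₁ (λ _ → refl))))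
                     (optimal (flip e′))
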